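{- There exists $N$ such that for all $n\ge N$, $$|A^{1324}(n)|>|A^{1423}(n)|>|A^{3412}(n)|.$$
   Context: A permutation $\sigma$ of $\{1,\dots,n\}$ is alternating if $\sigma_1<\sigma_2>\sigma_3<\sigma_4>\cdots$; $A_n$ is the set of such permutations. For $P\in A_4$ and $n\ge 4$, $A^{P}(n)$ is the set of $\sigma\in A_n$ whose prefix $\sigma_1\sigma_2\sigma_3\sigma_4$ is order-isomorphic to $P$ (has its entries in the same relative order as $P$). -}

module Defs where

open import Data.Nat using (ℕ; zero; suc; _<_; _>_; _<?_)
open import Data.Nat.Properties using (_≟_)
open import Data.List using (List; []; _∷_; _++_; length; filter; concatMap; map)
open import Data.List.Relation.Unary.Unique.Propositional using (Unique)
import Data.List.Relation.Unary.AllPairs as AP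
open import Data.Product using (_×_; _,_)
open import Data.Unit using (⊤; tt)
open import Data.Empty using (⊥)
open import Relation.Nullary using (Dec; yes; no; ¬_)
open import Relation.Nullary.Decidable using (_×-dec_; ¬?)

oneTo : ℕ → List ℕ
oneTo zero = []
oneTo (suc n) = oneTo n ++ (suc n ∷ [])

words : List ℕ → ℕ → List (List ℕ)
words xs zero = [] ∷ []
words xs (suc k) = concatMap (λ w → map (_∷ w) xs) (words xs k)

-- A permutation σ of {1,…,n} in one-line notation σ₁σ₂…σₙ is a word of
-- length n over {1,…,n} with pairwise distinct entries.
distinct? : (w : List ℕ) → Dec (Unique w)
distinct? w = AP.allPairs? (λ x y → ¬? (x ≟ y)) w

mutual
  Up : List ℕ → Set
  Up [] = ⊤
  Up (x ∷ []) = ⊤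
  Up (x ∷ y ∷ w) = (x < y) × Down (y ∷ w)

  Down : List ℕ → Set
  Down [] = ⊤
  Down (x ∷ []) = ⊤
  Down (x ∷ y ∷ w) = (x > y) × Up (y ∷ w)

mutual
  up? : (w : List ℕ) → Dec (Up w)
  up? [] = yes tt
  up? (x ∷ []) = yes tt
  up? (x ∷ y ∷ w) = (x <? y) ×-dec down? (y ∷ w)

  down? : (w : List ℕ) → Dec (Down w)
  down? [] = yes tt
  down? (x ∷ []) = yes tt
  down? (x ∷ y ∷ w) = (y <? x) ×-dec up? (y ∷ w)

Alternating : List ℕ → Set
Alternating = Up

alternating? : (w : List ℕ) → Dec (Alternating w)
alternating? = up?

SameOrder : ℕ → ℕ → ℕ → ℕ → Set
SameOrder a b c d = ((a < b) → (c < d)) × ((c < d) → (a < b))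

sameOrder? : ∀ a b c d → Dec (SameOrder a b c d)
sameOrder? a b c d with a <? b | c <? d
... | yes p | yes q = yes ((λ _ → q) , (λ _ → p))
... | yes p | no ¬q = no (λ { (f , _) → ¬q (f p) })
... | no ¬p | yes q = no (λ { (_ , g) → ¬p (g q) })
... | no ¬p | no ¬q = yes ((λ p → ⊥-elim' (¬p p)) , (λ q → ⊥-elim' (¬q q)))
  where
  ⊥-elim' : ∀ {A : Set} → ⊥ → A
  ⊥-elim' ()

PrefixIso : List ℕ → List ℕ → Set
PrefixIso (s1 ∷ s2 ∷ s3 ∷ s4 ∷ _) (p1 ∷ p2 ∷ p3 ∷ p4 ∷ []) =
  SameOrder s1 s2 p1 p2 × SameOrder s2 s1 p2 p1 ×
  SameOrder s1 s3 p1 p3 × SameOrder s3 s1 p3 p1 ×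
  SameOrder s1 s4 p1 p4 × SameOrder s4 s1 p4 p1 ×
  SameOrder s2 s3 p2 p3 × SameOrder s3 s2 p3 p2 ×
  SameOrder s2 s4 p2 p4 × SameOrder s4 s2 p4 p2 ×
  SameOrder s3 s4 p3 p4 × SameOrder s4 s3 p4 p3
PrefixIso _ _ = ⊥

prefixIso? : (w p : List ℕ) → Dec (PrefixIso w p)
prefixIso? (s1 ∷ s2 ∷ s3 ∷ s4 ∷ _) (p1 ∷ p2 ∷ p3 ∷ p4 ∷ []) =
  sameOrder? s1 s2 p1 p2 ×-dec sameOrder? s2 s1 p2 p1 ×-dec
  sameOrder? s1 s3 p1 p3 ×-dec sameOrder? s3 s1 p3 p1 ×-dec
  sameOrder? s1 s4 p1 p4 ×-dec sameOrder? s4 s1 p4 p1 ×-dec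
  sameOrder? s2 s3 p2 p3 ×-dec sameOrder? s3 s2 p3 p2 ×-dec
  sameOrder? s2 s4 p2 p4 ×-dec sameOrder? s4 s2 p4 p2 ×-dec
  sameOrder? s3 s4 p3 p4 ×-dec sameOrder? s4 s3 p4 p3
prefixIso? [] _ = no (λ ())
prefixIso? (_ ∷ []) _ = no (λ ())
prefixIso? (_ ∷ _ ∷ []) _ = no (λ ())
prefixIso? (_ ∷ _ ∷ _ ∷ []) _ = no (λ ())
prefixIso? (_ ∷ _ ∷ _ ∷ _ ∷ _) [] = no (λ ())
prefixIso? (_ ∷ _ ∷ _ ∷ _ ∷ _) (_ ∷ []) = no (λ ())
prefixIso? (_ ∷ _ ∷ _ ∷ _ ∷ _) (_ ∷ _ ∷ []) = no (λ ())
prefixIso? (_ ∷ _ ∷ _ ∷ _ ∷ _) (_ ∷ _ ∷ _ ∷ []) = no (λ ())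
prefixIso? (_ ∷ _ ∷ _ ∷ _ ∷ _) (_ ∷ _ ∷ _ ∷ _ ∷ _ ∷ _) = no (λ ())

perms : ℕ → List (List ℕ)
perms n = filter distinct? (words (oneTo n) n)

altPerms : ℕ → List (List ℕ)
altPerms n = filter alternating? (perms n)

AP : List ℕ → ℕ → List (List ℕ)
AP P n = filter (λ w → prefixIso? w P) (altPerms n)

countAP : List ℕ → ℕ → ℕ
countAP P n = length (AP P n)

{-# OPTIONS --safe #-}
module Submission where

-- Both inequalities come from injections that miss a point. Exchanging σ₂ and σ₄
-- maps A^1423(n) injectively into A^1324(n), and moving (σ₁, σ₃, σ₄) to positions
-- (4, 1, 3) maps A^3412(n) injectively into A^1423(n); both keep the word
-- alternating. As σ₄ > σ₅ in an alternating permutation, every image of the first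
-- map has σ₂ > σ₅ and every image of the second has σ₃ > σ₅. For n ≥ 5 the
-- alternating permutations 1 3 2 5 4 7 6 9 8 … and 1 5 2 4 3 7 6 9 8 … violate
-- this, so both inclusions are strict.

open import Defs
open import Data.Nat using (ℕ; zero; suc; _+_; _<_; _≤_; _>_; _<?_; z≤n; s≤s; s<s)
open import Data.Nat.Properties using (<-trans; <-asym; <⇒≢; n<1+n)
open import Data.List using (List; []; _∷_; _++_; length; map; concatMap; applyUpTo; cartesianProductWith)
open import Data.List.Properties using (length-map; length-applyUpTo; applyUpTo-∷ʳ; ∷-injective)
open import Data.List.Membership.Propositional using (_∈_; _∉_)
open import Data.List.Membership.Propositional.Properties
  using (∈-map⁻; ∈-cartesianProductWith⁺; ∈-cartesianProductWith⁻; ∈-filter⁺; ∈-filter⁻)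
open import Data.List.Relation.Unary.Any using (here; there)
open import Data.List.Relation.Unary.All as All using (All; []; _∷_)
open import Data.List.Relation.Unary.AllPairs using ([]; _∷_)
open import Data.List.Relation.Unary.Unique.Propositional using (Unique)
import Data.List.Relation.Unary.Unique.Propositional.Properties as Unique
open import Data.List.Relation.Binary.Permutation.Propositional
  using (_↭_; prep; swap; ↭-refl; ↭-sym; ↭-trans; ↭⇒↭ₛ)
open import Data.List.Relation.Binary.Permutation.Propositional.Properties using (All-resp-↭; ↭-length)
open import Data.List.Relation.Binary.Permutation.Setoid.Properties using (Unique-resp-↭)
import Data.List.Fresh as List#
import Data.List.Fresh.Relation.Unary.Any as Any#
open import Data.Product using (∃; _×_; _,_; proj₁; proj₂)
import Data.Product as Product
open import Data.Empty using (⊥-elim)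
open import Function using (_∘_; Injective)
open import Function.Consequences.Propositional using (inverseʳ⇒injective; strictlyInverseʳ⇒inverseʳ)
open import Relation.Nullary.Decidable using (True; toWitness)
open import Relation.Binary.PropositionalEquality
  using (_≡_; _≢_; refl; sym; trans; cong; subst; subst₂; setoid)

module _ {a} {A : Set a} where
  open import Data.List.Fresh.Membership.Setoid (setoid A) using () renaming (_∈_ to _∈#_)
  open import Data.List.Fresh.Membership.Setoid.Properties (setoid A) using (strict-injection)

  private
    length-fromList : ∀ {xs : List A} (xs! : Unique xs) → List#.length (List#.fromList xs!) ≡ length xs
    length-fromList []        = refl
    length-fromList (_ ∷ xs!) = cong suc (length-fromList xs!)

    ∈-fromList⁺ : ∀ {x xs} {xs! : Unique xs} → x ∈ xs → x ∈# List#.fromList xs!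
    ∈-fromList⁺ {xs! = _ ∷ _} (here x≡y) = Any#.here x≡y
    ∈-fromList⁺ {xs! = _ ∷ _} (there x∈) = Any#.there (∈-fromList⁺ x∈)

    ∈-fromList⁻ : ∀ {x xs} {xs! : Unique xs} → x ∈# List#.fromList xs! → x ∈ xs
    ∈-fromList⁻ {xs! = _ ∷ _} (Any#.here x≡y) = here x≡y
    ∈-fromList⁻ {xs! = _ ∷ _} (Any#.there x∈) = there (∈-fromList⁻ x∈)

  Unique-strict-subset⇒length< : ∀ {xs ys : List A} {b} → Unique xs → Unique ys →
                                 (∀ {x} → x ∈ xs → x ∈ ys) → b ∈ ys → b ∉ xs →
                                 length xs < length ys
  Unique-strict-subset⇒length< xs! ys! xs⊆ys b∈ys b∉xs =
    subst₂ _<_ (length-fromList xs!) (length-fromList ys!)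
      (strict-injection (λ x≢y → x≢y) (∈-fromList⁺ ∘ xs⊆ys ∘ ∈-fromList⁻)
                        (_ , ∈-fromList⁺ b∈ys , b∉xs ∘ ∈-fromList⁻))

strict-injection⇒length< : ∀ {a b} {A : Set a} {B : Set b} {f : A → B} {xs ys y} →
                           Injective _≡_ _≡_ f → Unique xs → Unique ys →
                           (∀ {x} → x ∈ xs → f x ∈ ys) → y ∈ ys → (∀ {x} → x ∈ xs → f x ≢ y) →
                           length xs < length ys
strict-injection⇒length< {f = f} {xs} {ys} {y} f-inj xs! ys! f[xs]⊆ys y∈ys y∉f[xs] =
  subst (_< length ys) (length-map f xs)
    (Unique-strict-subset⇒length< (Unique.map⁺ f-inj xs!) ys! image⊆ys y∈ys y∉image)
  where
  image⊆ys : ∀ {z} → z ∈ map f xs → z ∈ ys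
  image⊆ys z∈ with x , x∈ , refl ← ∈-map⁻ f z∈ = f[xs]⊆ys x∈
  y∉image : y ∉ map f xs
  y∉image y∈ with x , x∈ , refl ← ∈-map⁻ f y∈ = y∉f[xs] x∈ refl

oneTo≡applyUpTo : ∀ n → oneTo n ≡ applyUpTo suc n
oneTo≡applyUpTo zero    = refl
oneTo≡applyUpTo (suc n) = trans (cong (_++ suc n ∷ []) (oneTo≡applyUpTo n)) (applyUpTo-∷ʳ suc n)

Unique-oneTo : ∀ n → Unique (oneTo n)
Unique-oneTo n rewrite oneTo≡applyUpTo n = Unique.applyUpTo⁺₁ suc n (λ i<j _ → <⇒≢ (s<s i<j))

words-suc : ∀ (xs : List ℕ) k → words xs (suc k) ≡ cartesianProductWith (λ w x → x ∷ w) (words xs k) xs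
words-suc xs k = concatMap≡cartesianProductWith (words xs k)
  where
  concatMap≡cartesianProductWith : ∀ ws →
    concatMap (λ w → map (_∷ w) xs) ws ≡ cartesianProductWith (λ w x → x ∷ w) ws xs
  concatMap≡cartesianProductWith []       = refl
  concatMap≡cartesianProductWith (w ∷ ws) = cong (map (_∷ w) xs ++_) (concatMap≡cartesianProductWith ws)

∈-words⁺ : ∀ {xs w} → All (_∈ xs) w → w ∈ words xs (length w)
∈-words⁺ []                     = here refl
∈-words⁺ {xs} {x ∷ w} (x∈ ∷ w⊆) = subst (x ∷ w ∈_) (sym (words-suc xs (length w)))
  (∈-cartesianProductWith⁺ (λ w x → x ∷ w) (∈-words⁺ w⊆) x∈)

∈-words⁻ : ∀ {xs} k {w} → w ∈ words xs k → length w ≡ k × All (_∈ xs) w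
∈-words⁻ zero (here refl) = refl , []
∈-words⁻ {xs} (suc k) w∈
  with v , x , v∈ , x∈ , refl ← ∈-cartesianProductWith⁻ (λ w x → x ∷ w) (words xs k) xs
                                  (subst (_ ∈_) (words-suc xs k) w∈)
  with |v|≡k , v⊆ ← ∈-words⁻ k v∈ = cong suc |v|≡k , x∈ ∷ v⊆

Unique-words : ∀ {xs} k → Unique xs → Unique (words xs k)
Unique-words zero        _   = [] ∷ []
Unique-words {xs} (suc k) xs! = subst Unique (sym (words-suc xs k))
  (Unique.cartesianProductWith⁺ (λ w x → x ∷ w) (Product.swap ∘ ∷-injective) (Unique-words k xs!) xs!)

oneTo∈perms : ∀ n → oneTo n ∈ perms n
oneTo∈perms n =
  ∈-filter⁺ distinct? (subst (λ k → oneTo n ∈ words (oneTo n) k) |oneTo|≡n (∈-words⁺ (All.tabulate λ x∈ → x∈)))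
    (Unique-oneTo n)
  where
  |oneTo|≡n : length (oneTo n) ≡ n
  |oneTo|≡n = trans (cong length (oneTo≡applyUpTo n)) (length-applyUpTo suc n)

perms-resp-↭ : ∀ n {w w′} → w ↭ w′ → w ∈ perms n → w′ ∈ perms n
perms-resp-↭ n {w} {w′} w↭w′ w∈
  with w∈words , w! ← ∈-filter⁻ distinct? {xs = words (oneTo n) n} w∈
  with refl , w⊆ ← ∈-words⁻ n w∈words =
  ∈-filter⁺ distinct?
    (subst (λ k → w′ ∈ words (oneTo (length w)) k) (sym (↭-length w↭w′)) (∈-words⁺ (All-resp-↭ w↭w′ w⊆)))
    (Unique-resp-↭ (setoid ℕ) (↭⇒↭ₛ w↭w′) w!)

↭-applyUpTo⇒∈perms : ∀ n {w} → w ↭ applyUpTo suc n → w ∈ perms n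
↭-applyUpTo⇒∈perms n w↭ =
  perms-resp-↭ n (↭-sym w↭) (subst (_∈ perms n) (oneTo≡applyUpTo n) (oneTo∈perms n))

↭-swap₀₂ : ∀ {x y z : ℕ} {t} → x ∷ y ∷ z ∷ t ↭ z ∷ y ∷ x ∷ t
↭-swap₀₂ {x} {y} {z} = ↭-trans (swap x y ↭-refl) (↭-trans (prep y (swap x z ↭-refl)) (swap y z ↭-refl))

∈-AP⁺ : ∀ P n {w} → w ∈ perms n → Alternating w → PrefixIso w P → w ∈ AP P n
∈-AP⁺ P n w∈ alt iso = ∈-filter⁺ (λ w → prefixIso? w P) (∈-filter⁺ alternating? w∈ alt) iso

∈-AP⁻ : ∀ P n {w} → w ∈ AP P n → w ∈ perms n × Alternating w × PrefixIso w P
∈-AP⁻ P n w∈ with w∈alt , iso ← ∈-filter⁻ (λ w → prefixIso? w P) w∈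
             with w∈perms , alt ← ∈-filter⁻ alternating? w∈alt = w∈perms , alt , iso

∈-AP-elim : ∀ P n (Q : List ℕ → Set) →
            (∀ {a b c d r} → a ∷ b ∷ c ∷ d ∷ r ∈ AP P n → Q (a ∷ b ∷ c ∷ d ∷ r)) →
            ∀ {w} → w ∈ AP P n → Q w
∈-AP-elim P n Q long {a ∷ b ∷ c ∷ d ∷ r} w∈ = long w∈
∈-AP-elim P n Q long {[]}                 w∈ = ⊥-elim (proj₂ (proj₂ (∈-AP⁻ P n w∈)))
∈-AP-elim P n Q long {_ ∷ []}             w∈ = ⊥-elim (proj₂ (proj₂ (∈-AP⁻ P n w∈)))
∈-AP-elim P n Q long {_ ∷ _ ∷ []}         w∈ = ⊥-elim (proj₂ (proj₂ (∈-AP⁻ P n w∈)))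
∈-AP-elim P n Q long {_ ∷ _ ∷ _ ∷ []}     w∈ = ⊥-elim (proj₂ (proj₂ (∈-AP⁻ P n w∈)))

Unique-AP : ∀ P n → Unique (AP P n)
Unique-AP P n = Unique.filter⁺ (λ w → prefixIso? w P)
  (Unique.filter⁺ alternating? (Unique.filter⁺ distinct? (Unique-words n (Unique-oneTo n))))

<-lit : ∀ m n → {True (m <? n)} → m < n
<-lit m n {m<n} = toWitness m<n

SameOrder₂ : ℕ → ℕ → ℕ → ℕ → Set
SameOrder₂ x y p q = SameOrder x y p q × SameOrder y x q p

sameOrder₂ : ∀ {x y p q} → x < y → p < q → SameOrder₂ x y p q
sameOrder₂ x<y p<q =
  ((λ _ → p<q) , (λ _ → x<y)) , ((λ y<x → ⊥-elim (<-asym x<y y<x)) , (λ q<p → ⊥-elim (<-asym p<q q<p)))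

-- PrefixIso is a right-nested 12-tuple; this splices the SameOrder₂ pairs into it.
infixr 4 _,,_
_,,_ : ∀ {A B C : Set} → A × B → C → A × B × C
(a , b) ,, c = a , b , c

P1324 P1423 P3412 : List ℕ
P1324 = 1 ∷ 3 ∷ 2 ∷ 4 ∷ []
P1423 = 1 ∷ 4 ∷ 2 ∷ 3 ∷ []
P3412 = 3 ∷ 4 ∷ 1 ∷ 2 ∷ []

module _ {a b c d : ℕ} {r : List ℕ} where

  PrefixIso-1324⁺ : a < c → c < b → b < d → PrefixIso (a ∷ b ∷ c ∷ d ∷ r) P1324
  PrefixIso-1324⁺ a<c c<b b<d =
    sameOrder₂ a<b (<-lit 1 3) ,, sameOrder₂ a<c (<-lit 1 2) ,, sameOrder₂ a<d (<-lit 1 4) ,,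
    Product.swap (sameOrder₂ c<b (<-lit 2 3)) ,, sameOrder₂ b<d (<-lit 3 4) ,, sameOrder₂ c<d (<-lit 2 4)
    where
    a<b = <-trans a<c c<b
    a<d = <-trans a<b b<d
    c<d = <-trans c<b b<d

  PrefixIso-1423⁺ : a < c → c < d → d < b → PrefixIso (a ∷ b ∷ c ∷ d ∷ r) P1423
  PrefixIso-1423⁺ a<c c<d d<b =
    sameOrder₂ a<b (<-lit 1 4) ,, sameOrder₂ a<c (<-lit 1 2) ,, sameOrder₂ a<d (<-lit 1 3) ,,
    Product.swap (sameOrder₂ c<b (<-lit 2 4)) ,, Product.swap (sameOrder₂ d<b (<-lit 3 4)) ,,
    sameOrder₂ c<d (<-lit 2 3)
    where
    a<d = <-trans a<c c<d
    a<b = <-trans a<d d<b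
    c<b = <-trans c<d d<b

  PrefixIso-1423⁻ : PrefixIso (a ∷ b ∷ c ∷ d ∷ r) P1423 → a < c × c < d × d < b
  PrefixIso-1423⁻ (_ , _ , (_ , a<c) , _ , _ , _ , _ , _ , _ , (_ , d<b) , (_ , c<d) , _) =
    a<c (<-lit 1 2) , c<d (<-lit 2 3) , d<b (<-lit 3 4)

  PrefixIso-3412⁻ : PrefixIso (a ∷ b ∷ c ∷ d ∷ r) P3412 → c < d × d < a × a < b
  PrefixIso-3412⁻ ((_ , a<b) , _ , _ , _ , _ , (_ , d<a) , _ , _ , _ , _ , (_ , c<d) , _) =
    c<d (<-lit 1 2) , d<a (<-lit 2 3) , a<b (<-lit 3 4)

Down-raiseHead : ∀ {x y} r → x < y → Down (x ∷ r) → Down (y ∷ r)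
Down-raiseHead []      _   _           = _
Down-raiseHead (z ∷ r) x<y (z<x , alt) = <-trans z<x x<y , alt

swap₂₄ : List ℕ → List ℕ
swap₂₄ (a ∷ b ∷ c ∷ d ∷ r) = a ∷ d ∷ c ∷ b ∷ r
swap₂₄ w                   = w

swap₂₄-involutive : ∀ w → swap₂₄ (swap₂₄ w) ≡ w
swap₂₄-involutive (a ∷ b ∷ c ∷ d ∷ r) = refl
swap₂₄-involutive []                  = refl
swap₂₄-involutive (_ ∷ [])            = refl
swap₂₄-involutive (_ ∷ _ ∷ [])        = refl
swap₂₄-involutive (_ ∷ _ ∷ _ ∷ [])    = refl

swap₂₄-injective : Injective _≡_ _≡_ swap₂₄
swap₂₄-injective =
  inverseʳ⇒injective swap₂₄ (strictlyInverseʳ⇒inverseʳ {f⁻¹ = swap₂₄} swap₂₄ swap₂₄-involutive)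

swap₂₄-↭ : ∀ w → swap₂₄ w ↭ w
swap₂₄-↭ (a ∷ b ∷ c ∷ d ∷ r) = prep a ↭-swap₀₂
swap₂₄-↭ []                  = ↭-refl
swap₂₄-↭ (_ ∷ [])            = ↭-refl
swap₂₄-↭ (_ ∷ _ ∷ [])        = ↭-refl
swap₂₄-↭ (_ ∷ _ ∷ _ ∷ [])    = ↭-refl

swap₂₄-1423→1324 : ∀ n {w} → w ∈ AP P1423 n → swap₂₄ w ∈ AP P1324 n
swap₂₄-1423→1324 n = ∈-AP-elim P1423 n (λ w → swap₂₄ w ∈ AP P1324 n) long
  where
  long : ∀ {a b c d r} → a ∷ b ∷ c ∷ d ∷ r ∈ AP P1423 n → a ∷ d ∷ c ∷ b ∷ r ∈ AP P1324 n
  long {a} {b} {c} {d} {r} w∈ with w∈perms , (_ , _ , _ , d↓) , iso ← ∈-AP⁻ P1423 n w∈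
                              with a<c , c<d , d<b ← PrefixIso-1423⁻ {a} {b} {c} {d} {r} iso =
    ∈-AP⁺ P1324 n (perms-resp-↭ n (↭-sym (swap₂₄-↭ _)) w∈perms)
          (<-trans a<c c<d , c<d , <-trans c<d d<b , Down-raiseHead r d<b d↓)
          (PrefixIso-1324⁺ {r = r} a<c c<d d<b)

swap₂₄-image : ∀ {w x₁ x₂ x₃ x₄ x₅ t} → Up w → swap₂₄ w ≡ x₁ ∷ x₂ ∷ x₃ ∷ x₄ ∷ x₅ ∷ t → x₅ < x₂
swap₂₄-image {a ∷ b ∷ c ∷ d ∷ e ∷ r} (_ , _ , _ , e<d , _) refl = e<d
swap₂₄-image {[]}                 _ ()
swap₂₄-image {_ ∷ []}             _ ()
swap₂₄-image {_ ∷ _ ∷ []}         _ ()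
swap₂₄-image {_ ∷ _ ∷ _ ∷ []}     _ ()
swap₂₄-image {_ ∷ _ ∷ _ ∷ _ ∷ []} _ ()

rotate₁₃₄ : List ℕ → List ℕ
rotate₁₃₄ (a ∷ b ∷ c ∷ d ∷ r) = c ∷ b ∷ d ∷ a ∷ r
rotate₁₃₄ w                   = w

rotate₁₃₄-cube : ∀ w → rotate₁₃₄ (rotate₁₃₄ (rotate₁₃₄ w)) ≡ w
rotate₁₃₄-cube (a ∷ b ∷ c ∷ d ∷ r) = refl
rotate₁₃₄-cube []                  = refl
rotate₁₃₄-cube (_ ∷ [])            = refl
rotate₁₃₄-cube (_ ∷ _ ∷ [])        = refl
rotate₁₃₄-cube (_ ∷ _ ∷ _ ∷ [])    = refl

rotate₁₃₄-injective : Injective _≡_ _≡_ rotate₁₃₄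
rotate₁₃₄-injective = inverseʳ⇒injective rotate₁₃₄
  (strictlyInverseʳ⇒inverseʳ {f⁻¹ = rotate₁₃₄ ∘ rotate₁₃₄} rotate₁₃₄ rotate₁₃₄-cube)

rotate₁₃₄-↭ : ∀ w → rotate₁₃₄ w ↭ w
rotate₁₃₄-↭ (a ∷ b ∷ c ∷ d ∷ r) = ↭-trans (prep c (prep b (swap d a ↭-refl))) ↭-swap₀₂
rotate₁₃₄-↭ []                  = ↭-refl
rotate₁₃₄-↭ (_ ∷ [])            = ↭-refl
rotate₁₃₄-↭ (_ ∷ _ ∷ [])        = ↭-refl
rotate₁₃₄-↭ (_ ∷ _ ∷ _ ∷ [])    = ↭-refl

rotate₁₃₄-3412→1423 : ∀ n {w} → w ∈ AP P3412 n → rotate₁₃₄ w ∈ AP P1423 n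
rotate₁₃₄-3412→1423 n = ∈-AP-elim P3412 n (λ w → rotate₁₃₄ w ∈ AP P1423 n) long
  where
  long : ∀ {a b c d r} → a ∷ b ∷ c ∷ d ∷ r ∈ AP P3412 n → c ∷ b ∷ d ∷ a ∷ r ∈ AP P1423 n
  long {a} {b} {c} {d} {r} w∈ with w∈perms , (_ , _ , _ , d↓) , iso ← ∈-AP⁻ P3412 n w∈
                              with c<d , d<a , a<b ← PrefixIso-3412⁻ {a} {b} {c} {d} {r} iso =
    ∈-AP⁺ P1423 n (perms-resp-↭ n (↭-sym (rotate₁₃₄-↭ _)) w∈perms)
          (<-trans c<d d<b , d<b , d<a , Down-raiseHead r d<a d↓)
          (PrefixIso-1423⁺ {r = r} c<d d<a a<b)
    where d<b = <-trans d<a a<b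

rotate₁₃₄-image : ∀ {w x₁ x₂ x₃ x₄ x₅ t} → Up w → rotate₁₃₄ w ≡ x₁ ∷ x₂ ∷ x₃ ∷ x₄ ∷ x₅ ∷ t → x₅ < x₃
rotate₁₃₄-image {a ∷ b ∷ c ∷ d ∷ e ∷ r} (_ , _ , _ , e<d , _) refl = e<d
rotate₁₃₄-image {[]}                 _ ()
rotate₁₃₄-image {_ ∷ []}             _ ()
rotate₁₃₄-image {_ ∷ _ ∷ []}         _ ()
rotate₁₃₄-image {_ ∷ _ ∷ _ ∷ []}     _ ()
rotate₁₃₄-image {_ ∷ _ ∷ _ ∷ _ ∷ []} _ ()

swapPairs : List ℕ → List ℕ
swapPairs (x ∷ y ∷ t) = y ∷ x ∷ swapPairs t
swapPairs t           = t

swapPairs-↭ : ∀ t → swapPairs t ↭ t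
swapPairs-↭ (x ∷ y ∷ t) = swap y x (swapPairs-↭ t)
swapPairs-↭ []          = ↭-refl
swapPairs-↭ (_ ∷ [])    = ↭-refl

Up-swapPairs : ∀ {f x} m → (∀ i → f i < f (suc i)) → x < f 0 → Up (x ∷ swapPairs (applyUpTo f m))
Up-swapPairs zero          _      _    = _
Up-swapPairs (suc zero)    _      x<f₀ = x<f₀ , _
Up-swapPairs (suc (suc m)) f-mono x<f₀ =
  <-trans x<f₀ (f-mono 0) , f-mono 0 , Up-swapPairs m (f-mono ∘ suc ∘ suc) (<-trans (f-mono 0) (f-mono 1))

zigzagFrom6 : ℕ → List ℕ
zigzagFrom6 m = swapPairs (applyUpTo (6 +_) m)

W1324 W1423 : ℕ → List ℕ
W1324 m = 1 ∷ 3 ∷ 2 ∷ 5 ∷ 4 ∷ zigzagFrom6 m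
W1423 m = 1 ∷ 5 ∷ 2 ∷ 4 ∷ 3 ∷ zigzagFrom6 m

-- W1324 m unfolds to 1 ∷ swapPairs (applyUpTo (2 +_) (4 + m)).
W1324↭oneTo : ∀ m → W1324 m ↭ applyUpTo suc (5 + m)
W1324↭oneTo m = prep 1 (swapPairs-↭ (applyUpTo (2 +_) (4 + m)))

W1324∈AP : ∀ m → W1324 m ∈ AP P1324 (5 + m)
W1324∈AP m = ∈-AP⁺ P1324 (5 + m)
  (↭-applyUpTo⇒∈perms (5 + m) (W1324↭oneTo m))
  (Up-swapPairs (4 + m) (λ i → n<1+n (2 + i)) (<-lit 1 2))
  (PrefixIso-1324⁺ {r = 4 ∷ zigzagFrom6 m} (<-lit 1 2) (<-lit 2 3) (<-lit 3 5))

W1423∈AP : ∀ m → W1423 m ∈ AP P1423 (5 + m)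
W1423∈AP m = ∈-AP⁺ P1423 (5 + m)
  (↭-applyUpTo⇒∈perms (5 + m) (↭-trans W1423↭W1324 (W1324↭oneTo m)))
  (<-lit 1 5 , <-lit 2 5 , <-lit 2 4 , <-lit 3 4 , Up-swapPairs m (λ i → n<1+n (6 + i)) (<-lit 3 6))
  (PrefixIso-1423⁺ {r = 3 ∷ zigzagFrom6 m} (<-lit 1 2) (<-lit 2 4) (<-lit 4 5))
  where
  W1423↭W1324 : W1423 m ↭ W1324 m
  W1423↭W1324 = prep 1 (↭-trans (prep 5 (prep 2 (swap 4 3 ↭-refl))) ↭-swap₀₂)

count-1423<1324 : ∀ m → countAP P1423 (5 + m) < countAP P1324 (5 + m)
count-1423<1324 m =
  strict-injection⇒length< swap₂₄-injective (Unique-AP P1423 (5 + m)) (Unique-AP P1324 (5 + m))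
    (swap₂₄-1423→1324 (5 + m)) (W1324∈AP m)
    (λ w∈ eq → <-asym (swap₂₄-image (proj₁ (proj₂ (∈-AP⁻ P1423 (5 + m) w∈))) eq) (<-lit 3 4))

count-3412<1423 : ∀ m → countAP P3412 (5 + m) < countAP P1423 (5 + m)
count-3412<1423 m =
  strict-injection⇒length< rotate₁₃₄-injective (Unique-AP P3412 (5 + m)) (Unique-AP P1423 (5 + m))
    (rotate₁₃₄-3412→1423 (5 + m)) (W1423∈AP m)
    (λ w∈ eq → <-asym (rotate₁₃₄-image (proj₁ (proj₂ (∈-AP⁻ P3412 (5 + m) w∈))) eq) (<-lit 2 3))

mainTheorem12 : ∃ λ (N : ℕ) → ∀ (n : ℕ) → N ≤ n →
    (countAP (1 ∷ 3 ∷ 2 ∷ 4 ∷ []) n > countAP (1 ∷ 4 ∷ 2 ∷ 3 ∷ []) n)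
    × (countAP (1 ∷ 4 ∷ 2 ∷ 3 ∷ []) n > countAP (3 ∷ 4 ∷ 1 ∷ 2 ∷ []) n)
mainTheorem12 = 5 , λ where
  _ (s≤s (s≤s (s≤s (s≤s (s≤s (z≤n {m})))))) → count-1423<1324 m , count-3412<1423 m
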